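{- For every integer $r\ge 2$, the H-graph $H(r)$ satisfies $\chi_\rho(H(r))=5$ if $r$ is even, and $6\le \chi_\rho(H(r))\le 7$ if $r$ is odd.
   Context: All graphs are simple; $d_G(u,v)$ is the shortest-path distance. A packing $k$-colouring of $G$ is a map $\pi:V(G)\to\{1,\dots,k\}$ such that for distinct $u,v$, $\pi(u)=\pi(v)=i$ implies $d_G(u,v)>i$; $\chi_\rho(G)$ is the least $k$ for which a packing $k$-colouring exists. For $r\ge 2$, the H-graph $H(r)$ has vertex set $\{u_i,v_i,w_i: 0\le i\le 2r-1\}$ and edge set $\{u_iu_{i+1},\ w_iw_{i+1},\ u_iv_i,\ v_iw_i : 0\le i\le 2r-1\}\cup\{v_{2i}v_{2i+1}: 0\le i\le r-1\}$ (subscripts modulo $2r$); it is a 3-regular graph of order $6r$. -}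

module Defs where

open import Data.Nat using (ℕ; zero; suc; _+_; _*_; _≤_; _<_; _%_; NonZero)
open import Data.Fin using (Fin; toℕ)
open import Data.Product using (Σ; ∃; _×_; _,_)
open import Data.Sum using (_⊎_)
open import Relation.Binary.PropositionalEquality using (_≡_; _≢_)
open import Relation.Nullary using (¬_)
open import Level using (0ℓ) renaming (suc to lsuc)

-- A graph given by a vertex type and an adjacency relation
-- (for H(r) the relation below is symmetric and irreflexive, i.e. simple).
record Graph : Set₁ where
  field
    Vertex : Set
    Adj    : Vertex → Vertex → Set
open Graph public

data Walk (G : Graph) : Vertex G → Vertex G → ℕ → Set where
  here : ∀ {u} → Walk G u u 0
  step : ∀ {u w v k} → Adj G u w → Walk G w v k → Walk G u v (suc k)

-- d_G(u,v) ≤ i  (there is a walk, equivalently a path, of length at most i)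
DistLe : (G : Graph) → Vertex G → Vertex G → ℕ → Set
DistLe G u v i = Σ ℕ λ k → k ≤ i × Walk G u v k

-- d_G(u,v) > i  (including d = ∞ for disconnected u, v)
DistGt : (G : Graph) → Vertex G → Vertex G → ℕ → Set
DistGt G u v i = ¬ DistLe G u v i

-- A packing k-colouring; colour c : Fin k stands for the colour toℕ c + 1 ∈ {1..k}.
IsPackingColouring : (G : Graph) (k : ℕ) → (Vertex G → Fin k) → Set
IsPackingColouring G k π =
  ∀ u v → u ≢ v → π u ≡ π v → DistGt G u v (suc (toℕ (π u)))

HasPackingColouring : Graph → ℕ → Set
HasPackingColouring G k = Σ (Vertex G → Fin k) λ π → IsPackingColouring G k π

PackingChromaticNumber : Graph → ℕ → Set
PackingChromaticNumber G k =
  HasPackingColouring G k × (∀ m → m < k → ¬ HasPackingColouring G m)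

-- The H-graph H(r). Vertex (l , i) with l = 0,1,2 stands for u_i, v_i, w_i.
-- Indices i ∈ Fin (2r); i+1 is taken modulo 2r.
HAdj : (r : ℕ) → (Fin 3 × Fin (2 * r)) → (Fin 3 × Fin (2 * r)) → Set
HAdj r (l , i) (l' , j) =
    ((toℕ l ≡ 0 ⊎ toℕ l ≡ 2) × toℕ l ≡ toℕ l' ×
       (toℕ j ≡ succMod (toℕ i) ⊎ toℕ i ≡ succMod (toℕ j)))
  ⊎
    (toℕ i ≡ toℕ j × ((toℕ l ≡ 1 × (toℕ l' ≡ 0 ⊎ toℕ l' ≡ 2))
                     ⊎ (toℕ l' ≡ 1 × (toℕ l ≡ 0 ⊎ toℕ l ≡ 2))))
  ⊎
    (toℕ l ≡ 1 × toℕ l' ≡ 1 ×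
       ((∃ λ m → toℕ i ≡ 2 * m × toℕ j ≡ suc (2 * m))
      ⊎ (∃ λ m → toℕ j ≡ 2 * m × toℕ i ≡ suc (2 * m))))
  where
  succMod : ℕ → ℕ
  succMod x with 2 * r
  ... | zero   = 0
  ... | suc n  = suc x % suc n

H : ℕ → Graph
H r = record { Vertex = Fin 3 × Fin (2 * r) ; Adj = HAdj r }

-- Unroll H(r) along its two cycles into an infinite ladder whose columns ℕ lie over the columns
-- ℤ/2r of H(r).  The projection sends ladder walks to walks of H(r), and every walk of H(r) of
-- length at most D from the image of a vertex in ladder column D lifts.  So a colouring of H(r) is a packing
-- colouring as soon as, around each vertex, the lifted colouring of a ball of radius 8 in the ladder
-- is one; for the colourings below this is a finite computation that does not depend on r: a
-- 4-periodic 5-colouring when 4 ∣ 2r, and for odd r a 7-colouring that is 4-periodic apart from a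
-- block of six columns (for r < 11 the lifted check is simply run on H(r) itself).
-- Conversely a packing colouring of H(r) lifts to a packing colouring of any window of at most
-- 2r ladder columns, and an exhaustive search over windows shows that four colours never suffice and
-- that with five colours colour 4 lies on exactly one of any two consecutive rungs v₂ₜv₂ₜ₊₁.  The
-- rungs then alternate, so their number r is even.  For odd r this leaves χ_ρ ∈ {6, 7}, and which of
-- the two it is can be decided since H(r) is finite.
module Submission where

open import Defs
open import Data.Bool using (Bool; true; false; T; not; _∧_; _∨_; _xor_; if_then_else_)
open import Data.Bool.ListAction using (all; any)
open import Data.Bool.Properties using (T-∧; T-∨; not-¬; not-involutive)
open import Data.Fin using (Fin; toℕ; fromℕ<; inject≤; #_; _↑ˡ_; finToFun; funToFin)
open import Data.Fin.Patterns using (0F; 1F; 2F)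
open import Data.Fin.Properties
  using (toℕ-injective; toℕ<n; toℕ-fromℕ<; toℕ-inject≤; toℕ-↑ˡ; finToFun-funToFin; *↔×)
  renaming (_≟_ to _≟ᶠ_; any? to anyFin?; all? to allFin?)
open import Data.List using (List; []; _∷_; _++_; concatMap; allFin; upTo)
open import Data.List.Membership.Propositional using (_∈_; find; lose)
open import Data.List.Membership.Propositional.Properties
  using (∈-++⁻; ∈-++⁺ˡ; ∈-++⁺ʳ; ∈-concatMap⁺; ∈-concatMap⁻; ∈-allFin; ∈-upTo⁺)
open import Data.List.Relation.Unary.All as All using (All; []; _∷_)
open import Data.List.Relation.Unary.All.Properties using (all⁺)
open import Data.List.Relation.Unary.Any using (Any; here; there)
open import Data.List.Relation.Unary.Any.Properties using (any⁻)
open import Data.Nat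
  using (ℕ; zero; suc; pred; _+_; _*_; _^_; _∸_; _≤_; _<_; _%_; _/_; _≡ᵇ_; ∣_-_∣; _⊓_;
         NonZero; z≤n; s≤s; z<s; _≤?_; _<?_)
open import Data.Nat.Properties
open import Data.Nat.DivMod
open import Data.Nat.Divisibility using (_∣_; divides; ∣m+n∣m⇒∣n; n∣m*n; >⇒∤; m%n≡0⇒n∣m; *-monoʳ-∣)
open import Data.Nat.Tactic.RingSolver using (solve-∀)
open import Data.Product using (Σ; ∃; _×_; _,_; proj₁; proj₂)
open import Data.Product.Properties using (≡-dec)
open import Data.Sum using (_⊎_; inj₁; inj₂; [_,_])
open import Function using (_∘_; _↔_; Inverse)
open import Function.Bundles using (Equivalence)
open import Relation.Binary using (DecidableEquality)
open import Relation.Binary.PropositionalEquality hiding ([_])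
open import Relation.Nullary using (¬_; Dec; yes; no; contradiction)
open import Relation.Nullary.Decidable
  using (True; False; isYes; isNo; toWitness; toWitnessFalse; map′; _×-dec_; _⊎-dec_; _→-dec_; ¬?)

[m%d+n]%d≡[m+n]%d : ∀ m n d .{{_ : NonZero d}} → (m % d + n) % d ≡ (m + n) % d
[m%d+n]%d≡[m+n]%d m n d = begin
  (m % d + n) % d          ≡⟨ %-distribˡ-+ (m % d) n d ⟩
  (m % d % d + n % d) % d  ≡⟨ cong (λ x → (x + n % d) % d) (m%n%n≡m%n m d) ⟩
  (m % d + n % d) % d      ≡⟨ %-distribˡ-+ m n d ⟨
  (m + n) % d              ∎
  where open ≡-Reasoning

[m+d]%n≡m%n⇒n∣d : ∀ m d n .{{_ : NonZero n}} → (m + d) % n ≡ m % n → n ∣ d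
[m+d]%n≡m%n⇒n∣d m d n eq = ∣m+n∣m⇒∣n (subst (n ∣_) multiple (n∣m*n ((m + d) / n))) (n∣m*n (m / n))
  where
  multiple : (m + d) / n * n ≡ m / n * n + d
  multiple = +-cancelˡ-≡ (m % n) _ _ (begin
    m % n + (m + d) / n * n        ≡⟨ cong (_+ (m + d) / n * n) eq ⟨
    (m + d) % n + (m + d) / n * n  ≡⟨ m≡m%n+[m/n]*n (m + d) n ⟨
    m + d                          ≡⟨ cong (_+ d) (m≡m%n+[m/n]*n m n) ⟩
    m % n + m / n * n + d          ≡⟨ +-assoc (m % n) _ d ⟩
    m % n + (m / n * n + d)        ∎)
    where open ≡-Reasoning

%-injective-≤ : ∀ {x y} n .{{_ : NonZero n}} → x ≤ y → y < x + n → x % n ≡ y % n → x ≡ y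
%-injective-≤ {x} {y} n x≤y y<x+n eq with y ∸ x | m+[n∸m]≡n x≤y
... | zero  | x+0≡y = trans (sym (+-identityʳ x)) x+0≡y
... | suc d | x+d≡y = contradiction n∣d (>⇒∤ d<n)
  where
  n∣d : n ∣ suc d
  n∣d = [m+d]%n≡m%n⇒n∣d x (suc d) n (trans (cong (_% n) x+d≡y) (sym eq))
  d<n : suc d < n
  d<n = +-cancelˡ-< x (suc d) n (subst (_< x + n) (sym x+d≡y) y<x+n)

%-injective-window : ∀ {z x y} n .{{_ : NonZero n}} → z ≤ x → z ≤ y → x < z + n → y < z + n →
                     x % n ≡ y % n → x ≡ y
%-injective-window n z≤x z≤y x<z+n y<z+n eq with ≤-total _ _
... | inj₁ x≤y = %-injective-≤ n x≤y (<-≤-trans y<z+n (+-monoˡ-≤ n z≤x)) eq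
... | inj₂ y≤x = sym (%-injective-≤ n y≤x (<-≤-trans x<z+n (+-monoˡ-≤ n z≤y)) (sym eq))

y+z≡t+z+k*n⇒y%n≡t : ∀ {y t} z k n .{{_ : NonZero n}} → y + z ≡ t + z + k * n → t < n → y % n ≡ t
y+z≡t+z+k*n⇒y%n≡t {y} {t} z k n eq t<n = begin
  y % n            ≡⟨ cong (_% n) (+-cancelʳ-≡ z y (t + k * n) (trans eq (+-swap-last t z (k * n)))) ⟩
  (t + k * n) % n  ≡⟨ [m+kn]%n≡m%n t k n ⟩
  t % n            ≡⟨ m<n⇒m%n≡m t<n ⟩
  t                ∎
  where
  open ≡-Reasoning
  +-swap-last : ∀ a b c → a + b + c ≡ a + c + b
  +-swap-last = solve-∀

parity : ∀ x → x % 2 ≡ 0 ⊎ x % 2 ≡ 1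
parity zero          = inj₁ refl
parity (suc zero)    = inj₂ refl
parity (suc (suc x)) = parity x

even-suc : ∀ x → x % 2 ≡ 0 → suc x % 2 ≡ 1
even-suc zero          _  = refl
even-suc (suc zero)    ()
even-suc (suc (suc x)) eq = even-suc x eq

odd-suc : ∀ x → x % 2 ≡ 1 → suc x % 2 ≡ 0
odd-suc zero          ()
odd-suc (suc zero)    _  = refl
odd-suc (suc (suc x)) eq = odd-suc x eq

even-before-odd : ∀ x D {k} → (x + suc D) % 2 ≡ suc k → (x + D) % 2 ≡ 0
even-before-odd x D odd with parity (x + D)
... | inj₁ even = even
... | inj₂ odd′ = contradiction (trans (sym (odd-suc (x + D) odd′)) (trans (cong (_% 2) (sym (+-suc x D))) odd)) 0≢1+n

even⇒double : ∀ {x} → x % 2 ≡ 0 → x ≡ 2 * (x / 2)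
even⇒double {x} even = trans (m≡m%n+[m/n]*n x 2) (trans (cong (_+ x / 2 * 2) even) (*-comm (x / 2) 2))

2*m%2≡0 : ∀ m → 2 * m % 2 ≡ 0
2*m%2≡0 m = trans (cong (_% 2) (*-comm 2 m)) (m*n%n≡0 m 2)

odd⇒suc-double : ∀ {m} → ¬ 2 ∣ m → ∃ λ s → m ≡ suc (2 * s)
odd⇒suc-double {m} 2∤m with parity m
... | inj₁ even = contradiction (m%n≡0⇒n∣m m 2 even) 2∤m
... | inj₂ odd  = m / 2 , trans (m≡m%n+[m/n]*n m 2) (cong₂ _+_ odd (*-comm (m / 2) 2))

alternating-even : (h : ℕ → Bool) → (∀ t → h (suc t) ≡ not (h t)) → ∀ s → h (2 * s) ≡ h 0
alternating-even h flips zero    = refl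
alternating-even h flips (suc s) = begin
  h (2 * suc s)          ≡⟨ cong h (*-suc 2 s) ⟩
  h (suc (suc (2 * s)))  ≡⟨ flips (suc (2 * s)) ⟩
  not (h (suc (2 * s)))  ≡⟨ cong not (flips (2 * s)) ⟩
  not (not (h (2 * s)))  ≡⟨ not-involutive (h (2 * s)) ⟩
  h (2 * s)              ≡⟨ alternating-even h flips s ⟩
  h 0                    ∎
  where open ≡-Reasoning

alternating-odd : (h : ℕ → Bool) → (∀ t → h (suc t) ≡ not (h t)) → ∀ s → h (suc (2 * s)) ≡ not (h 0)
alternating-odd h flips s = trans (flips (2 * s)) (cong not (alternating-even h flips s))

xor-not : ∀ {x y} → T (x xor y) → y ≡ not x
xor-not {false} {true}  _ = refl
xor-not {true}  {false} _ = refl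

T-all-∈ : ∀ {A : Set} (p : A → Bool) xs {x} → T (all p xs) → x ∈ xs → T (p x)
T-all-∈ p xs ok x∈ = All.lookup (all⁺ p xs ok) x∈

T-all²-∈ : ∀ {A B : Set} (p : A → B → Bool) xs ys {x y} → T (all (λ x → all (p x) ys) xs) →
           x ∈ xs → y ∈ ys → T (p x y)
T-all²-∈ p xs ys ok x∈ y∈ = T-all-∈ (p _) ys (T-all-∈ (λ x → all (p x) ys) xs ok x∈) y∈

module _ {G G′ : Graph} (f : Vertex G → Vertex G′) (f-adj : ∀ {x y} → Adj G x y → Adj G′ (f x) (f y)) where

  Walk-map : ∀ {x y k} → Walk G x y k → Walk G′ (f x) (f y) k
  Walk-map here       = here
  Walk-map (step e w) = step (f-adj e) (Walk-map w)

  DistLe-map : ∀ {x y k} → DistLe G x y k → DistLe G′ (f x) (f y) k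
  DistLe-map (j , j≤k , w) = j , j≤k , Walk-map w

IsPackingColouring-inject≤ : ∀ {G a b} (π : Vertex G → Fin a) (a≤b : a ≤ b) →
  IsPackingColouring G a π → IsPackingColouring G b (λ v → inject≤ (π v) a≤b)
IsPackingColouring-inject≤ {G} π a≤b packed u v u≢v same-colour close =
  packed u v u≢v (toℕ-injective (begin
      toℕ (π u)                ≡⟨ toℕ-inject≤ (π u) a≤b ⟨
      toℕ (inject≤ (π u) a≤b)  ≡⟨ cong toℕ same-colour ⟩
      toℕ (inject≤ (π v) a≤b)  ≡⟨ toℕ-inject≤ (π v) a≤b ⟩
      toℕ (π v)                ∎))
    (subst (λ c → DistLe G u v (suc c)) (toℕ-inject≤ (π u) a≤b) close)
  where open ≡-Reasoning

IsPackingColouring-resp-≗ : ∀ {G K} {π π′ : Vertex G → Fin K} → (∀ v → π v ≡ π′ v) →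
                            IsPackingColouring G K π → IsPackingColouring G K π′
IsPackingColouring-resp-≗ {G} π≗π′ packed u v u≢v same-colour close =
  packed u v u≢v (trans (π≗π′ u) (trans same-colour (sym (π≗π′ v))))
    (subst (λ c → DistLe G u v (suc (toℕ c))) (sym (π≗π′ u)) close)

HasPackingColouring-mono : ∀ {G a b} → a ≤ b → HasPackingColouring G a → HasPackingColouring G b
HasPackingColouring-mono a≤b (π , packed) = _ , IsPackingColouring-inject≤ π a≤b packed

packingChromaticNumber-suc : ∀ {G k} → HasPackingColouring G (suc k) → ¬ HasPackingColouring G k →
                             PackingChromaticNumber G (suc k)
packingChromaticNumber-suc has ¬has = has , λ m m<1+k → ¬has ∘ HasPackingColouring-mono (≤-pred m<1+k)

packingChromaticNumber-between : ∀ {G k} → Dec (HasPackingColouring G (suc k)) → ¬ HasPackingColouring G k →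
  HasPackingColouring G (suc (suc k)) → Σ ℕ λ j → PackingChromaticNumber G j × suc k ≤ j × j ≤ suc (suc k)
packingChromaticNumber-between (yes has) ¬has _   = _ , packingChromaticNumber-suc has ¬has , ≤-refl , n≤1+n _
packingChromaticNumber-between (no ¬has) _    has = _ , packingChromaticNumber-suc has ¬has , n≤1+n _ , ≤-refl

module FiniteGraph (G : Graph) {N : ℕ} (enumeration : Fin N ↔ Vertex G)
                   (_≟_ : DecidableEquality (Vertex G)) (adj? : ∀ u v → Dec (Adj G u v)) where
  open Inverse enumeration using (to; from; strictlyInverseˡ)

  ∀? : {P : Vertex G → Set} → (∀ v → Dec (P v)) → Dec (∀ v → P v)
  ∀? {P} P? = map′ (λ h v → subst P (strictlyInverseˡ v) (h (from v))) (λ h i → h (to i)) (allFin? (P? ∘ to))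

  ∃? : {P : Vertex G → Set} → (∀ v → Dec (P v)) → Dec (Σ (Vertex G) P)
  ∃? {P} P? = map′ (λ (i , p) → to i , p) (λ (v , p) → from v , subst P (sym (strictlyInverseˡ v)) p)
                   (anyFin? (P? ∘ to))

  walk? : ∀ k u v → Dec (Walk G u v k)
  walk? zero    u v = map′ (λ { refl → here }) (λ { here → refl }) (u ≟ v)
  walk? (suc k) u v = map′ (λ (w , e , walk) → step e walk) (λ { (step e walk) → _ , e , walk })
                           (∃? λ w → adj? u w ×-dec walk? k w v)

  distLe? : ∀ i u v → Dec (DistLe G u v i)
  distLe? i u v =
    map′ (λ (k , walk) → toℕ k , ≤-pred (toℕ<n k) , walk)
         (λ (k , k≤i , walk) → fromℕ< (s≤s k≤i) , subst (Walk G u v) (sym (toℕ-fromℕ< (s≤s k≤i))) walk)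
         (anyFin? {suc i} λ k → walk? (toℕ k) u v)

  isPackingColouring? : ∀ {K} (π : Vertex G → Fin K) → Dec (IsPackingColouring G K π)
  isPackingColouring? π = ∀? λ u → ∀? λ v → ¬? (u ≟ v) →-dec (π u ≟ᶠ π v) →-dec ¬? (distLe? _ u v)

  hasPackingColouring? : ∀ K → Dec (HasPackingColouring G K)
  hasPackingColouring? K =
    map′ (λ (c , packed) → colouring c , packed)
         (λ (π , packed) → funToFin (π ∘ to) , IsPackingColouring-resp-≗ (decode π) packed)
         (anyFin? (isPackingColouring? ∘ colouring))
    where
    colouring : Fin (K ^ N) → Vertex G → Fin K
    colouring c = finToFun c ∘ from
    decode : ∀ π v → π v ≡ colouring (funToFin (π ∘ to)) v
    decode π v = sym (trans (finToFun-funToFin (π ∘ to) (from v)) (cong π (strictlyInverseˡ v)))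

-- The ladder

-- (l , D) is vertex u, v or w (l = 0, 1, 2) of column D; the rung between columns D and D + 1 is
-- present iff b + D is even, so that the ladder covers H(r) with column 0 over a column of parity b.
LadderVertex : Set
LadderVertex = Fin 3 × ℕ

_≟ᴸ_ : DecidableEquality LadderVertex
_≟ᴸ_ = ≡-dec _≟ᶠ_ _≟_

predecessor : Fin 3 → ℕ → List LadderVertex
predecessor l zero    = []
predecessor l (suc D) = (l , D) ∷ []

rung : ℕ → ℕ → List LadderVertex
rung zero    D = (1F , suc D) ∷ []
rung (suc _) D = predecessor 1F D

neighbours : ℕ → LadderVertex → List LadderVertex
neighbours b (0F , D) = (1F , D) ∷ (0F , suc D) ∷ predecessor 0F D
neighbours b (1F , D) = (0F , D) ∷ (2F , D) ∷ rung ((b + D) % 2) D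
neighbours b (2F , D) = (1F , D) ∷ (2F , suc D) ∷ predecessor 2F D

Ladder : ℕ → Graph
Ladder b = record { Vertex = LadderVertex ; Adj = λ x y → y ∈ neighbours b x }

Outer : Fin 3 → Set
Outer l = toℕ l ≡ 0 ⊎ toℕ l ≡ 2

outer-forward∈ : ∀ {b l D} → Outer l → (l , suc D) ∈ neighbours b (l , D)
outer-forward∈ {l = 0F} _ = there (here refl)
outer-forward∈ {l = 2F} _ = there (here refl)
outer-forward∈ {l = 1F} (inj₁ ())
outer-forward∈ {l = 1F} (inj₂ ())

outer-backward∈ : ∀ {b l D} → Outer l → (l , D) ∈ neighbours b (l , suc D)
outer-backward∈ {l = 0F} _ = there (there (here refl))
outer-backward∈ {l = 2F} _ = there (there (here refl))
outer-backward∈ {l = 1F} (inj₁ ())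
outer-backward∈ {l = 1F} (inj₂ ())

Spoke : Fin 3 → Fin 3 → Set
Spoke l l′ = (toℕ l ≡ 1 × Outer l′) ⊎ (toℕ l′ ≡ 1 × Outer l)

spoke∈ : ∀ {b l l′ D} → Spoke l l′ → (l′ , D) ∈ neighbours b (l , D)
spoke∈ {l = 1F} {0F} _ = here refl
spoke∈ {l = 1F} {2F} _ = there (here refl)
spoke∈ {l = 0F} {1F} _ = here refl
spoke∈ {l = 2F} {1F} _ = here refl
spoke∈ {l = 0F} {0F} (inj₁ (() , _))
spoke∈ {l = 0F} {0F} (inj₂ (() , _))
spoke∈ {l = 0F} {2F} (inj₁ (() , _))
spoke∈ {l = 0F} {2F} (inj₂ (() , _))
spoke∈ {l = 2F} {0F} (inj₁ (() , _))
spoke∈ {l = 2F} {0F} (inj₂ (() , _))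
spoke∈ {l = 2F} {2F} (inj₁ (() , _))
spoke∈ {l = 2F} {2F} (inj₂ (() , _))
spoke∈ {l = 1F} {1F} (inj₁ (_ , inj₁ ()))
spoke∈ {l = 1F} {1F} (inj₁ (_ , inj₂ ()))
spoke∈ {l = 1F} {1F} (inj₂ (_ , inj₁ ()))
spoke∈ {l = 1F} {1F} (inj₂ (_ , inj₂ ()))

rung-forward∈ : ∀ {b D} → (b + D) % 2 ≡ 0 → (1F , suc D) ∈ neighbours b (1F , D)
rung-forward∈ even rewrite even = there (there (here refl))

rung-backward∈ : ∀ {b D} → (b + suc D) % 2 ≡ 1 → (1F , D) ∈ neighbours b (1F , suc D)
rung-backward∈ odd rewrite odd = there (there (here refl))

ColumnNear : ℕ → ℕ → Set
ColumnNear D D′ = pred D ≤ D′ × D′ ≤ suc D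

same-column-near : ∀ D → ColumnNear D D
same-column-near D = pred[n]≤n , n≤1+n D

next-column-near : ∀ D → ColumnNear D (suc D)
next-column-near D = ≤-trans pred[n]≤n (n≤1+n D) , ≤-refl

predecessor-near : ∀ {l D y} → y ∈ predecessor l D → ColumnNear D (proj₂ y)
predecessor-near {D = suc D} (here refl) = ≤-refl , m≤n⇒m≤1+n (n≤1+n D)

neighbour-near : ∀ {b l D y} → y ∈ neighbours b (l , D) → ColumnNear D (proj₂ y)
neighbour-near {l = 0F} {D} (here refl)         = same-column-near D
neighbour-near {l = 0F} {D} (there (here refl)) = next-column-near D
neighbour-near {l = 0F}     (there (there y∈))  = predecessor-near y∈
neighbour-near {l = 2F} {D} (here refl)         = same-column-near D
neighbour-near {l = 2F} {D} (there (here refl)) = next-column-near D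
neighbour-near {l = 2F}     (there (there y∈))  = predecessor-near y∈
neighbour-near {l = 1F} {D} (here refl)         = same-column-near D
neighbour-near {l = 1F} {D} (there (here refl)) = same-column-near D
neighbour-near {b} {1F} {D} (there (there y∈)) with (b + D) % 2
... | zero  with y∈
...   | here refl = next-column-near D
neighbour-near {b} {1F} {D} (there (there y∈)) | suc _ = predecessor-near y∈

Walk-column : ∀ {b x z k} → Walk (Ladder b) x z k → proj₂ z ≤ proj₂ x + k
Walk-column {x = x} here = m≤m+n (proj₂ x) 0
Walk-column {x = x} {k = suc k} (step {w = w} y∈ walk) =
  ≤-trans (Walk-column walk)
          (subst (proj₂ w + k ≤_) (sym (+-suc (proj₂ x) k)) (+-monoˡ-≤ k (proj₂ (neighbour-near y∈))))

ball : ℕ → ℕ → LadderVertex → List LadderVertex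
ball b zero    x = x ∷ []
ball b (suc k) x = x ∷ concatMap (ball b k) (neighbours b x)

centre∈ball : ∀ {b} k x → x ∈ ball b k x
centre∈ball zero    x = here refl
centre∈ball (suc k) x = here refl

Walk⇒∈ball : ∀ {b k x y j} → j ≤ k → Walk (Ladder b) x y j → y ∈ ball b k x
Walk⇒∈ball {k = k} _ here = centre∈ball k _
Walk⇒∈ball {k = suc k} (s≤s j≤k) (step w∈ walk) =
  there (∈-concatMap⁺ (ball _ k) (lose w∈ (Walk⇒∈ball j≤k walk)))

ball-complete : ∀ {b k x y} → DistLe (Ladder b) x y k → y ∈ ball b k x
ball-complete (_ , j≤k , walk) = Walk⇒∈ball j≤k walk

ball-sound : ∀ {b k x y} → y ∈ ball b k x → DistLe (Ladder b) x y k
ball-sound {k = zero}  (here refl) = 0 , z≤n , here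
ball-sound {k = suc k} (here refl) = 0 , z≤n , here
ball-sound {b} {suc k} (there y∈) with find (∈-concatMap⁻ (ball b k) y∈)
... | w , w∈ , y∈′ with ball-sound y∈′
...   | j , j≤k , walk = suc j , s≤s j≤k , step w∈ walk

packedAround : (LadderVertex → ℕ) → ℕ → LadderVertex → (LadderVertex → Bool) → Bool
packedAround colour b x exempt = all (λ z → isNo (colour z ≟ colour x) ∨ exempt z) (ball b (colour x) x)

packedAround-sound : ∀ {colour b x exempt z} → T (packedAround colour b x exempt) →
                     DistLe (Ladder b) x z (colour x) → colour z ≡ colour x → T (exempt z)
packedAround-sound {colour} {b} {x} {exempt} {z} ok close same-colour
  with Equivalence.to (T-∨ {isNo (colour z ≟ colour x)}) (T-all-∈ _ _ ok (ball-complete close))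
... | inj₁ different = contradiction same-colour (toWitnessFalse different)
... | inj₂ exempt-z  = exempt-z

isCentre : LadderVertex → LadderVertex → Bool
isCentre x z = isYes (z ≟ᴸ x)

columnVertices : ℕ → List LadderVertex
columnVertices D = (0F , D) ∷ (1F , D) ∷ (2F , D) ∷ []

window : ℕ → ℕ → List LadderVertex
window lo zero    = []
window lo (suc w) = columnVertices lo ++ window (suc lo) w

window-columns : ∀ lo w {x} → x ∈ window lo w → lo ≤ proj₂ x × proj₂ x < lo + w
window-columns lo (suc w) {x} x∈ with ∈-++⁻ (columnVertices lo) x∈
... | inj₁ (here refl)                 = ≤-refl , m<m+n lo z<s
... | inj₁ (there (here refl))         = ≤-refl , m<m+n lo z<s
... | inj₁ (there (there (here refl))) = ≤-refl , m<m+n lo z<s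
... | inj₂ x∈′ with window-columns (suc lo) w x∈′
...   | lo<D , D<1+lo+w = <⇒≤ lo<D , subst (proj₂ x <_) (sym (+-suc lo w)) D<1+lo+w

∈-window : ∀ lo w {l D} → lo ≤ D → D < lo + w → (l , D) ∈ window lo w
∈-window lo zero    lo≤D D<lo+0 = contradiction (subst (_ <_) (+-identityʳ lo) D<lo+0) (≤⇒≯ lo≤D)
∈-window lo (suc w) {l} {D} lo≤D D<lo+1+w with m≤n⇒m<n∨m≡n lo≤D
... | inj₁ lo<D = ∈-++⁺ʳ (columnVertices lo) (∈-window (suc lo) w lo<D (subst (D <_) (+-suc lo w) D<lo+1+w))
... | inj₂ refl = ∈-++⁺ˡ (∈-columnVertices l)
  where
  ∈-columnVertices : ∀ l → (l , lo) ∈ columnVertices lo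
  ∈-columnVertices 0F = here refl
  ∈-columnVertices 1F = there (here refl)
  ∈-columnVertices 2F = there (there (here refl))

-- A guess for the distance in the ladder; only its certified values (distancesCertified) are used.
ladderDistance : ℕ → LadderVertex → LadderVertex → ℕ
ladderDistance b (1F , D) (1F , D′) with ∣ D - D′ ∣
... | 0           = 0
... | 1           = if (b + D ⊓ D′) % 2 ≡ᵇ 0 then 1 else 3
... | suc (suc d) = d + 4
ladderDistance b (l , D) (l′ , D′) = ∣ D - D′ ∣ + ∣ toℕ l - toℕ l′ ∣

near : ℕ → LadderVertex → LadderVertex → ℕ → Bool
near b x y c = isYes (ladderDistance b x y ≤? c)

distancesCertified : ℕ → ℕ → List LadderVertex → Bool
distancesCertified b k W =
  all (λ x → all (λ y → isNo (ladderDistance b x y ≤? k) ∨ isYes (y ∈? ball b (ladderDistance b x y) x)) W) W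
  where open import Data.List.Membership.DecPropositional _≟ᴸ_ using (_∈?_)

near-sound : ∀ {b k W x y c} → T (distancesCertified b k W) → x ∈ W → y ∈ W → c ≤ k →
             T (near b x y c) → DistLe (Ladder b) x y c
near-sound {b} {k} {W} {x} {y} {c} certified x∈ y∈ c≤k close
  with Equivalence.to (T-∨ {isNo (ladderDistance b x y ≤? k)}) (T-all-∈ _ W (T-all-∈ _ W certified x∈) y∈)
... | inj₁ far  = contradiction (≤-trans (toWitness close) c≤k) (toWitnessFalse far)
... | inj₂ path with ball-sound (toWitness path)
...   | j , j≤d , walk = j , ≤-trans j≤d (toWitness close) , walk

-- Exhaustive search for packing colourings of a list of vertices

module PackingSearch {A : Set} (_≟_ : DecidableEquality A) (near : A → A → ℕ → Bool) (k : ℕ)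
                     (goal : (A → ℕ) → Bool) where

  Assignment : Set
  Assignment = List (A × Fin k)

  colourOf : Assignment → A → ℕ
  colourOf []             x = 0
  colourOf ((y , c) ∷ as) x = if isYes (y ≟ x) then suc (toℕ c) else colourOf as x

  clashes : A → Fin k → A × Fin k → Bool
  clashes y c (x , c′) = isYes (c′ ≟ᶠ c) ∧ (isNo (x ≟ y) ∧ near x y (suc (toℕ c)))

  search : List A → Assignment → Bool
  search []       as = goal (colourOf as)
  search (y ∷ ys) as = all (λ c → any (clashes y c) as ∨ search ys ((y , c) ∷ as)) (allFin k)

  module _ (W : List A) (f : A → Fin k)
           (packed : ∀ {x y} → x ∈ W → y ∈ W → x ≢ y → f x ≡ f y → ¬ T (near x y (suc (toℕ (f x)))))
           where

    Agrees : A × Fin k → Set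
    Agrees (x , c) = x ∈ W × f x ≡ c

    colourOf-agrees : ∀ as → All Agrees as → ∀ {x} → Any ((x ≡_) ∘ proj₁) as →
                      colourOf as x ≡ suc (toℕ (f x))
    colourOf-agrees ((y , c) ∷ as) ((_ , fy≡c) ∷ agrees) {x} x∈ with y ≟ x | x∈
    ... | yes refl | _        = cong (suc ∘ toℕ) (sym fy≡c)
    ... | no  y≢x  | here x≡y = contradiction (sym x≡y) y≢x
    ... | no  _    | there x∈′ = colourOf-agrees as agrees x∈′

    clash-impossible : ∀ {x y c} → x ∈ W → y ∈ W → f x ≡ c → ¬ T (clashes y (f y) (x , c))
    clash-impossible {x} {y} {c} x∈ y∈ fx≡c clash =
      packed x∈ y∈ (toWitnessFalse (proj₁ distinct×close)) fx≡fy
        (subst (λ c → T (near x y (suc (toℕ c)))) (sym fx≡fy) (proj₂ distinct×close))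
      where
      same : True (c ≟ᶠ f y)
      same = proj₁ (Equivalence.to (T-∧ {isYes (c ≟ᶠ f y)}) clash)
      distinct×close : False (x ≟ y) × T (near x y (suc (toℕ (f y))))
      distinct×close = Equivalence.to (T-∧ {isNo (x ≟ y)}) (proj₂ (Equivalence.to (T-∧ {isYes (c ≟ᶠ f y)}) clash))
      fx≡fy : f x ≡ f y
      fx≡fy = trans fx≡c (toWitness same)

    no-clash : ∀ {y} as → y ∈ W → All Agrees as → ¬ T (any (clashes y (f y)) as)
    no-clash {y} as y∈ agrees clash with find (any⁻ (clashes y (f y)) as clash)
    ... | (x , c) , x∈as , clash-x = clash-impossible (proj₁ agreement) y∈ (proj₂ agreement) clash-x
      where agreement = All.lookup agrees x∈as

    search-sound′ : ∀ ys as → All (_∈ W) ys → All Agrees as → T (search ys as) →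
                    Σ (A → ℕ) λ g → T (goal g) ×
                      (∀ {x} → x ∈ ys ⊎ Any ((x ≡_) ∘ proj₁) as → g x ≡ suc (toℕ (f x)))
    search-sound′ [] as _ agrees ok = colourOf as , ok , [ (λ ()) , colourOf-agrees as agrees ]
    search-sound′ (y ∷ ys) as (y∈ ∷ ys⊆) agrees ok
      with Equivalence.to T-∨ (T-all-∈ _ (allFin k) ok (∈-allFin (f y)))
    ... | inj₁ clash = contradiction clash (no-clash as y∈ agrees)
    ... | inj₂ ok′ with search-sound′ ys ((y , f y) ∷ as) ys⊆ ((y∈ , refl) ∷ agrees) ok′
    ... | g , goal-g , g≗f = g , goal-g , g≗f ∘ reassociate
      where
      reassociate : ∀ {x} → x ∈ y ∷ ys ⊎ Any ((x ≡_) ∘ proj₁) as →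
                    x ∈ ys ⊎ Any ((x ≡_) ∘ proj₁) ((y , f y) ∷ as)
      reassociate (inj₁ (here x≡y)) = inj₂ (here x≡y)
      reassociate (inj₁ (there x∈)) = inj₁ x∈
      reassociate (inj₂ x∈)         = inj₂ (there x∈)

    search-sound : T (search W []) →
                   Σ (A → ℕ) λ g → T (goal g) × (∀ {x} → x ∈ W → g x ≡ suc (toℕ (f x)))
    search-sound ok with search-sound′ W [] (All.tabulate (λ x∈ → x∈)) [] ok
    ... | g , goal-g , g≗f = g , goal-g , g≗f ∘ inj₁

-- The ladder covers H(r)

module Covering (r′ : ℕ) where

  r : ℕ
  r = suc r′

  n : ℕ
  n = 2 * r

  column : ℕ → ℕ → Fin n
  column a D = fromℕ< (m%n<n (a + D) n)

  project : ℕ → LadderVertex → Vertex (H r)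
  project a (l , D) = l , column a D

  toℕ-column : ∀ a D → toℕ (column a D) ≡ (a + D) % n
  toℕ-column a D = toℕ-fromℕ< (m%n<n (a + D) n)

  column-≡ : ∀ a D {j : Fin n} → (a + D) % n ≡ toℕ j → column a D ≡ j
  column-≡ a D eq = toℕ-injective (trans (toℕ-column a D) eq)

  suc-%-injective : ∀ {x y} → x < n → y < n → suc x % n ≡ suc y % n → x ≡ y
  suc-%-injective x<n y<n eq = suc-injective (%-injective-window n (s≤s z≤n) (s≤s z≤n) (s≤s x<n) (s≤s y<n) eq)

  %-suc : ∀ a D → (a + suc D) % n ≡ suc ((a + D) % n) % n
  %-suc a D = begin
    (a + suc D) % n        ≡⟨ cong (_% n) (trans (+-suc a D) (+-comm 1 (a + D))) ⟩
    (a + D + 1) % n        ≡⟨ [m%d+n]%d≡[m+n]%d (a + D) 1 n ⟨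
    ((a + D) % n + 1) % n  ≡⟨ cong (_% n) (+-comm _ 1) ⟩
    suc ((a + D) % n) % n  ∎
    where open ≡-Reasoning

  column-suc : ∀ a D → toℕ (column a (suc D)) ≡ suc (toℕ (column a D)) % n
  column-suc a D = trans (toℕ-column a (suc D)) (trans (%-suc a D) (cong (λ c → suc c % n) (sym (toℕ-column a D))))

  column-parity : ∀ a D → toℕ (column a D) % 2 ≡ (a % 2 + D) % 2
  column-parity a D = begin
    toℕ (column a D) % 2  ≡⟨ cong (_% 2) (toℕ-column a D) ⟩
    (a + D) % n % 2       ≡⟨ m∣n⇒o%n%m≡o%m 2 n (a + D) (divides r (*-comm 2 r)) ⟩
    (a + D) % 2           ≡⟨ [m%d+n]%d≡[m+n]%d a D 2 ⟨
    (a % 2 + D) % 2       ∎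
    where open ≡-Reasoning

  RungColumns : ℕ → ℕ → Set
  RungColumns a D = ∃ λ M → toℕ (column a D) ≡ 2 * M × toℕ (column a (suc D)) ≡ suc (2 * M)

  rung-columns : ∀ a D → (a % 2 + D) % 2 ≡ 0 → RungColumns a D
  rung-columns a D even = c / 2 , even⇒double c-even , (begin
    toℕ (column a (suc D))  ≡⟨ column-suc a D ⟩
    suc c % n               ≡⟨ m<n⇒m%n≡m 1+c<n ⟩
    suc c                   ≡⟨ cong suc (even⇒double c-even) ⟩
    suc (2 * (c / 2))       ∎)
    where
    open ≡-Reasoning
    c = toℕ (column a D)
    c-even : c % 2 ≡ 0
    c-even = trans (column-parity a D) even
    1+c<n : suc c < n
    1+c<n with m≤n⇒m<n∨m≡n (toℕ<n (column a D))
    ... | inj₁ 1+c<n = 1+c<n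
    ... | inj₂ 1+c≡n = contradiction (trans (sym (even-suc c c-even)) (trans (cong (_% 2) 1+c≡n) (2*m%2≡0 r))) λ ()

  project-adj : ∀ a {x y} → y ∈ neighbours (a % 2) x → HAdj r (project a x) (project a y)
  project-adj a {0F , D}     (here refl)                = inj₂ (inj₁ (refl , inj₂ (refl , inj₁ refl)))
  project-adj a {0F , D}     (there (here refl))        = inj₁ (inj₁ refl , refl , inj₁ (column-suc a D))
  project-adj a {0F , suc D} (there (there (here refl))) = inj₁ (inj₁ refl , refl , inj₂ (column-suc a D))
  project-adj a {2F , D}     (here refl)                = inj₂ (inj₁ (refl , inj₂ (refl , inj₂ refl)))
  project-adj a {2F , D}     (there (here refl))        = inj₁ (inj₂ refl , refl , inj₁ (column-suc a D))
  project-adj a {2F , suc D} (there (there (here refl))) = inj₁ (inj₂ refl , refl , inj₂ (column-suc a D))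
  project-adj a {1F , D}     (here refl)                = inj₂ (inj₁ (refl , inj₁ (refl , inj₁ refl)))
  project-adj a {1F , D}     (there (here refl))        = inj₂ (inj₁ (refl , inj₁ (refl , inj₂ refl)))
  project-adj a {1F , D}     (there (there y∈)) with (a % 2 + D) % 2 in rung-parity
  project-adj a {1F , D}     (there (there (here refl))) | zero =
    inj₂ (inj₂ (refl , refl , inj₁ (rung-columns a D rung-parity)))
  project-adj a {1F , suc D} (there (there (here refl))) | suc _ =
    inj₂ (inj₂ (refl , refl , inj₂ (rung-columns a D (even-before-odd (a % 2) D rung-parity))))

  Lift : ℕ → LadderVertex → Vertex (H r) → Set
  Lift a x w = Σ LadderVertex λ y → y ∈ neighbours (a % 2) x × project a y ≡ w

  lift-horizontal : ∀ a {l l′ D} {j : Fin n} → Outer l → toℕ l ≡ toℕ l′ →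
    let i = toℕ (column a (suc D)) in toℕ j ≡ suc i % n ⊎ i ≡ suc (toℕ j) % n → Lift a (l , suc D) (l′ , j)
  lift-horizontal a {l} outer l≡l′ dir with toℕ-injective {j = l} (sym l≡l′)
  lift-horizontal a {l} {D = D} outer _ (inj₁ forward) | refl =
    _ , outer-forward∈ outer , cong (l ,_) (toℕ-injective (trans (column-suc a (suc D)) (sym forward)))
  lift-horizontal a {l} {D = D} {j} outer _ (inj₂ backward) | refl =
    _ , outer-backward∈ outer ,
    cong (l ,_) (toℕ-injective (suc-%-injective (toℕ<n (column a D)) (toℕ<n j)
                                 (trans (sym (column-suc a D)) backward)))

  lift-spoke : ∀ a {l l′ D} {j : Fin n} → toℕ (column a (suc D)) ≡ toℕ j → Spoke l l′ →
               Lift a (l , suc D) (l′ , j)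
  lift-spoke a same spoke = _ , spoke∈ spoke , cong (_ ,_) (toℕ-injective same)

  lift-rung : ∀ a {D} {j : Fin n} → let i = toℕ (column a (suc D)) in
    (∃ λ M → i ≡ 2 * M × toℕ j ≡ suc (2 * M)) ⊎ (∃ λ M → toℕ j ≡ 2 * M × i ≡ suc (2 * M)) →
    Lift a (1F , suc D) (1F , j)
  lift-rung a {D} {j} (inj₁ (M , i≡2M , j≡1+2M)) =
    _ , rung-forward∈ {a % 2} even , cong (1F ,_) (toℕ-injective (begin
      toℕ (column a (suc (suc D)))  ≡⟨ column-suc a (suc D) ⟩
      suc i % n                     ≡⟨ cong (λ x → suc x % n) i≡2M ⟩
      suc (2 * M) % n               ≡⟨ cong (_% n) j≡1+2M ⟨
      toℕ j % n                     ≡⟨ m<n⇒m%n≡m (toℕ<n j) ⟩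
      toℕ j                         ∎))
    where
    open ≡-Reasoning
    i = toℕ (column a (suc D))
    even : (a % 2 + suc D) % 2 ≡ 0
    even = trans (sym (column-parity a (suc D))) (trans (cong (_% 2) i≡2M) (2*m%2≡0 M))
  lift-rung a {D} {j} (inj₂ (M , j≡2M , i≡1+2M)) =
    _ , rung-backward∈ {a % 2} odd , cong (1F ,_) (toℕ-injective (suc-%-injective (toℕ<n (column a D)) (toℕ<n j) (begin
      suc (toℕ (column a D)) % n  ≡⟨ column-suc a D ⟨
      i                           ≡⟨ i≡1+j ⟩
      suc (toℕ j)                 ≡⟨ m<n⇒m%n≡m (subst (_< n) i≡1+j (toℕ<n (column a (suc D)))) ⟨
      suc (toℕ j) % n             ∎)))
    where
    open ≡-Reasoning
    i = toℕ (column a (suc D))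
    i≡1+j : i ≡ suc (toℕ j)
    i≡1+j = trans i≡1+2M (cong suc (sym j≡2M))
    odd : (a % 2 + suc D) % 2 ≡ 1
    odd = trans (sym (column-parity a (suc D))) (trans (cong (_% 2) i≡1+2M) (even-suc (2 * M) (2*m%2≡0 M)))

  lift-adj : ∀ a l D w → HAdj r (project a (l , suc D)) w → Lift a (l , suc D) w
  lift-adj a l  D (l′ , j) (inj₁ (outer , l≡l′ , dir))   = lift-horizontal a outer l≡l′ dir
  lift-adj a l  D (l′ , j) (inj₂ (inj₁ (same , spoke)))  = lift-spoke a same spoke
  lift-adj a 1F D (1F , j) (inj₂ (inj₂ (_ , _ , rungs))) = lift-rung a rungs
  lift-adj a 0F D _        (inj₂ (inj₂ (() , _)))
  lift-adj a 2F D _        (inj₂ (inj₂ (() , _)))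
  lift-adj a 1F D (0F , j) (inj₂ (inj₂ (_ , () , _)))
  lift-adj a 1F D (2F , j) (inj₂ (inj₂ (_ , () , _)))

  lift-Walk : ∀ a {k l D v} → k ≤ D → Walk (H r) (project a (l , D)) v k →
              Σ LadderVertex λ z → Walk (Ladder (a % 2)) (l , D) z k × project a z ≡ v
  lift-Walk a _ here = _ , here , refl
  lift-Walk a {l = l} {suc D} (s≤s k≤D) (step {w = w} e walk) with lift-adj a l D w e
  ... | y , y∈ , refl with lift-Walk a (≤-trans k≤D (proj₁ (neighbour-near y∈))) walk
  ...   | z , walk′ , z↦v = z , step y∈ walk′ , z↦v

  project-DistLe : ∀ a {x y k} → DistLe (Ladder (a % 2)) x y k → DistLe (H r) (project a x) (project a y) k
  project-DistLe a = DistLe-map (project a) (project-adj a)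

  project-injective-window : ∀ a lo w {x y} → w ≤ n → x ∈ window lo w → y ∈ window lo w →
                             project a x ≡ project a y → x ≡ y
  project-injective-window a lo w {l , D} {l′ , D′} w≤n x∈ y∈ eq =
    cong₂ _,_ (cong proj₁ eq) (+-cancelˡ-≡ a D D′
      (%-injective-window n (+-monoʳ-≤ a (proj₁ (window-columns lo w x∈)))
                            (+-monoʳ-≤ a (proj₁ (window-columns lo w y∈)))
                            (bound (proj₂ (window-columns lo w x∈)))
                            (bound (proj₂ (window-columns lo w y∈))) columns))
    where
    bound : ∀ {E} → E < lo + w → a + E < a + lo + n
    bound {E} E<lo+w = subst (a + E <_) (sym (+-assoc a lo n)) (+-monoʳ-< a (<-≤-trans E<lo+w (+-monoʳ-≤ lo w≤n)))
    columns : (a + D) % n ≡ (a + D′) % n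
    columns = trans (sym (toℕ-column a D)) (trans (cong (toℕ ∘ proj₂) eq) (toℕ-column a D′))

  -- i − 8 modulo 2r, written without truncated subtraction
  offset : Fin n → ℕ
  offset i = toℕ i + pred n * 8

  project-centre : ∀ i l → project (offset i) (l , 8) ≡ (l , i)
  project-centre i l = cong (l ,_) (column-≡ (offset i) 8 (begin
    (toℕ i + pred n * 8 + 8) % n  ≡⟨ cong (_% n) (lemma (toℕ i) (pred n)) ⟩
    (toℕ i + 8 * n) % n           ≡⟨ [m+kn]%n≡m%n (toℕ i) 8 n ⟩
    toℕ i % n                     ≡⟨ m<n⇒m%n≡m (toℕ<n i) ⟩
    toℕ i                         ∎))
    where
    open ≡-Reasoning
    lemma : ∀ x p → x + p * 8 + 8 ≡ x + 8 * suc p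
    lemma = solve-∀

  offset-parity : ∀ i → offset i % 2 ≡ toℕ i % 2
  offset-parity i = trans (cong (λ x → (toℕ i + x) % 2) (sym (*-assoc (pred n) 4 2)))
                          ([m+kn]%n≡m%n (toℕ i) (pred n * 4) 2)

  -- over-centre may accept ladder vertices other than (l , 8): when 2r is small the ball of
  -- radius 8 around (l , 8) wraps around H(r).
  record Certificate {K} (π : Vertex (H r) → Fin K) (i : Fin n) (l : Fin 3) : Set where
    field
      colour            : LadderVertex → ℕ
      over-centre       : LadderVertex → Bool
      packed            : T (packedAround colour (toℕ i % 2) (l , 8) over-centre)
      colour-agrees     : ∀ l′ D → D ≤ 16 → colour (l′ , D) ≡ suc (toℕ (π (project (offset i) (l′ , D))))
      over-centre-sound : ∀ z → T (over-centre z) → project (offset i) z ≡ (l , i)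

  isCentre-sound : ∀ i l z → T (isCentre (l , 8) z) → project (offset i) z ≡ (l , i)
  isCentre-sound i l z z≡centre = trans (cong (project (offset i)) (toWitness z≡centre)) (project-centre i l)

  packing-from-certificates : ∀ {K} (π : Vertex (H r) → Fin K) → K ≤ 8 → (∀ i l → Certificate π i l) →
                              IsPackingColouring (H r) K π
  packing-from-certificates {K} π K≤8 certificate (l , i) v u≢v same-colour (k , k≤ , walk)
    with lift-Walk (offset i) (≤-trans k≤ (≤-trans (toℕ<n (π (l , i))) K≤8))
                   (subst (λ u → Walk (H r) u v k) (sym (project-centre i l)) walk)
  ... | (l′ , D) , ladder-walk , refl =
    u≢v (sym (over-centre-sound (l′ , D) (packedAround-sound {colour} {exempt = over-centre} packed′ close colours)))
    where
    open Certificate (certificate i l)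
    packed′ : T (packedAround colour (offset i % 2) (l , 8) over-centre)
    packed′ = subst (λ b → T (packedAround colour b (l , 8) over-centre)) (sym (offset-parity i)) packed
    centre-colour : colour (l , 8) ≡ suc (toℕ (π (l , i)))
    centre-colour = trans (colour-agrees l 8 (+-monoʳ-≤ 8 (z≤n {8}))) (cong (suc ∘ toℕ ∘ π) (project-centre i l))
    close : DistLe (Ladder (offset i % 2)) (l , 8) (l′ , D) (colour (l , 8))
    close = k , subst (k ≤_) (sym centre-colour) k≤ , ladder-walk
    colours : colour (l′ , D) ≡ colour (l , 8)
    colours = begin
      colour (l′ , D)                              ≡⟨ colour-agrees l′ D D≤16 ⟩
      suc (toℕ (π (project (offset i) (l′ , D))))  ≡⟨ cong (suc ∘ toℕ) same-colour ⟨
      suc (toℕ (π (l , i)))                        ≡⟨ centre-colour ⟨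
      colour (l , 8)                               ∎
      where
      open ≡-Reasoning
      D≤16 : D ≤ 16
      D≤16 = ≤-trans (Walk-column ladder-walk) (+-monoʳ-≤ 8 (≤-trans k≤ (≤-trans (toℕ<n (π (l , i))) K≤8)))

  module Computed {K} (π : Vertex (H r) → Fin K) where

    liftedColour : Fin n → LadderVertex → ℕ
    liftedColour i z = suc (toℕ (π (project (offset i) z)))

    projectsTo : Fin n → Fin 3 → LadderVertex → Bool
    projectsTo i l z = isYes (≡-dec _≟ᶠ_ _≟ᶠ_ (project (offset i) z) (l , i))

    localCheck : Fin n → Fin 3 → Bool
    localCheck i l = packedAround (liftedColour i) (toℕ i % 2) (l , 8) (projectsTo i l)

    allLocalChecks : Bool
    allLocalChecks = all (λ i → all (localCheck i) (allFin 3)) (allFin n)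

    computed-certificate : T allLocalChecks → ∀ i l → Certificate π i l
    computed-certificate ok i l = record
      { colour            = liftedColour i
      ; over-centre       = projectsTo i l
      ; packed            = T-all²-∈ localCheck (allFin n) (allFin 3) ok (∈-allFin i) (∈-allFin l)
      ; colour-agrees     = λ _ _ _ → refl
      ; over-centre-sound = λ _ → toWitness
      }

-- The colourings

periodic : Fin 3 → ℕ → Fin 5
periodic 0F 0 = # 0
periodic 0F 1 = # 1
periodic 0F 2 = # 0
periodic 0F _ = # 2
periodic 1F 0 = # 3
periodic 1F 1 = # 0
periodic 1F 2 = # 4
periodic 1F _ = # 0
periodic 2F 0 = # 0
periodic 2F 1 = # 2
periodic 2F 2 = # 0
periodic 2F _ = # 1

periodicLadder : ℕ → LadderVertex → ℕ
periodicLadder φ (l , D) = suc (toℕ (periodic l ((φ + D) % 4)))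

periodicCheck : ℕ → Fin 3 → Bool
periodicCheck φ l = packedAround (periodicLadder φ) (φ % 2) (l , 8) (isCentre (l , 8))

periodicLadder-packed : ∀ φ → φ < 4 → ∀ l → T (periodicCheck φ l)
periodicLadder-packed φ φ<4 l =
  T-all²-∈ periodicCheck (upTo 4) (allFin 3) _ (∈-upTo⁺ φ<4) (∈-allFin l)

seamBlock : Fin 3 → ℕ → Fin 7
seamBlock 0F 0 = # 5
seamBlock 0F 1 = # 0
seamBlock 0F 2 = # 1
seamBlock 0F 3 = # 2
seamBlock 0F 4 = # 0
seamBlock 0F _ = # 1
seamBlock 1F 0 = # 0
seamBlock 1F 1 = # 3
seamBlock 1F 2 = # 4
seamBlock 1F 3 = # 0
seamBlock 1F 4 = # 3
seamBlock 1F _ = # 0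
seamBlock 2F 0 = # 1
seamBlock 2F 1 = # 0
seamBlock 2F 2 = # 6
seamBlock 2F 3 = # 1
seamBlock 2F 4 = # 0
seamBlock 2F _ = # 2

oddColour : Fin 3 → ℕ → Fin 7
oddColour l j with j <? 6
... | yes _ = seamBlock l j
... | no  _ = periodic l (j % 4) ↑ˡ 2

oddColouring : ∀ {n} → Fin 3 × Fin n → Fin 7
oddColouring (l , i) = oddColour l (toℕ i)

oddColour-periodic : ∀ l j → 6 ≤ j → toℕ (oddColour l j) ≡ toℕ (periodic l (j % 4))
oddColour-periodic l j 6≤j with j <? 6
... | yes j<6 = contradiction j<6 (≤⇒≯ 6≤j)
... | no  _   = toℕ-↑ˡ (periodic l (j % 4)) 2

-- The odd colouring lifted to the ladder with the seam between columns 2r − 1 and 0 of H(r) lying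
-- left of ladder column 16 − s.  Left of the seam the columns of H(r) are 2r − 16 + s + D ≥ 6, whose
-- residue mod 4 is s + D + 2 because 2r ≡ 2 (mod 4).
seamLadder : ℕ → LadderVertex → ℕ
seamLadder s (l , D) with 16 ≤? s + D
... | yes _ = suc (toℕ (oddColour l (s + D ∸ 16)))
... | no  _ = suc (toℕ (periodic l ((s + D + 2) % 4)))

seamLadder-right : ∀ s l D → 16 ≤ s + D → seamLadder s (l , D) ≡ suc (toℕ (oddColour l (s + D ∸ 16)))
seamLadder-right s l D 16≤s+D with 16 ≤? s + D
... | yes _      = refl
... | no  s+D≱16 = contradiction 16≤s+D s+D≱16

seamLadder-left : ∀ s l D → s + D < 16 → seamLadder s (l , D) ≡ suc (toℕ (periodic l ((s + D + 2) % 4)))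
seamLadder-left s l D s+D<16 with 16 ≤? s + D
... | yes 16≤s+D = contradiction s+D<16 (≤⇒≯ 16≤s+D)
... | no  _      = refl

seamCheck : ℕ → Fin 3 → Bool
seamCheck s l = packedAround (seamLadder s) (s % 2) (l , 8) (isCentre (l , 8))

seamLadder-packed : ∀ s → s < 22 → ∀ l → T (seamCheck s l)
seamLadder-packed s s<22 l =
  T-all²-∈ seamCheck (upTo 22) (allFin 3) _ (∈-upTo⁺ s<22) (∈-allFin l)

module EvenColouring (r′ : ℕ) (4∣n : 4 ∣ Covering.n r′) where
  open Covering r′

  evenColouring : Vertex (H r) → Fin 5
  evenColouring (l , i) = periodic l (toℕ i % 4)

  column-mod-4 : ∀ i D → toℕ (column (offset i) D) % 4 ≡ (toℕ i % 4 + D) % 4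
  column-mod-4 i D = begin
    toℕ (column (offset i) D) % 4     ≡⟨ cong (_% 4) (toℕ-column (offset i) D) ⟩
    (offset i + D) % n % 4            ≡⟨ m∣n⇒o%n%m≡o%m 4 n (offset i + D) 4∣n ⟩
    (toℕ i + pred n * 8 + D) % 4      ≡⟨ cong (_% 4) (lemma (toℕ i) (pred n) D) ⟩
    (toℕ i + D + pred n * 2 * 4) % 4  ≡⟨ [m+kn]%n≡m%n (toℕ i + D) (pred n * 2) 4 ⟩
    (toℕ i + D) % 4                   ≡⟨ [m%d+n]%d≡[m+n]%d (toℕ i) D 4 ⟨
    (toℕ i % 4 + D) % 4               ∎
    where
    open ≡-Reasoning
    lemma : ∀ x p D → x + p * 8 + D ≡ x + D + p * 2 * 4
    lemma = solve-∀

  certificate : ∀ i l → Certificate evenColouring i l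
  certificate i l = record
    { colour            = periodicLadder (toℕ i % 4)
    ; over-centre       = isCentre (l , 8)
    ; packed            = subst (λ b → T (packedAround (periodicLadder (toℕ i % 4)) b (l , 8) (isCentre (l , 8))))
                                (m∣n⇒o%n%m≡o%m 2 4 (toℕ i) (divides 2 refl))
                                (periodicLadder-packed (toℕ i % 4) (m%n<n (toℕ i) 4) l)
    ; colour-agrees     = λ l′ D _ → cong (λ x → suc (toℕ (periodic l′ x))) (sym (column-mod-4 i D))
    ; over-centre-sound = isCentre-sound i l
    }

  evenColouring-packing : IsPackingColouring (H r) 5 evenColouring
  evenColouring-packing = packing-from-certificates evenColouring (+-monoʳ-≤ 5 (z≤n {3})) certificate

module OddColouring (r′ : ℕ) (22≤n : 22 ≤ Covering.n r′) (n%4≡2 : Covering.n r′ % 4 ≡ 2) where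
  open Covering r′

  seam : Fin n → ℕ
  seam i = (toℕ i + 8) % n

  seam-parity : ∀ i → seam i % 2 ≡ toℕ i % 2
  seam-parity i = trans (m∣n⇒o%n%m≡o%m 2 n (toℕ i + 8) (divides r (*-comm 2 r))) ([m+kn]%n≡m%n (toℕ i) 4 2)

  offset-seam : ∀ i D → offset i + D + 16 ≡ seam i + D + ((toℕ i + 8) / n + 8) * n
  offset-seam i D = begin
    toℕ i + pred n * 8 + D + 16               ≡⟨ lemma₁ (toℕ i) (pred n) D ⟩
    toℕ i + 8 + D + 8 * n                     ≡⟨ cong (λ x → x + D + 8 * n) (m≡m%n+[m/n]*n (toℕ i + 8) n) ⟩
    seam i + (toℕ i + 8) / n * n + D + 8 * n  ≡⟨ lemma₂ (seam i) ((toℕ i + 8) / n) D n ⟩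
    seam i + D + ((toℕ i + 8) / n + 8) * n    ∎
    where
    open ≡-Reasoning
    lemma₁ : ∀ x p D → x + p * 8 + D + 16 ≡ x + 8 + D + 8 * suc p
    lemma₁ = solve-∀
    lemma₂ : ∀ s q D n → s + q * n + D + 8 * n ≡ s + D + (q + 8) * n
    lemma₂ = solve-∀

  column+16≡by-shift : ∀ i D {X t k} → t + 16 ≡ X → offset i + D + 16 ≡ X + k * n → X < n + 16 →
                toℕ (column (offset i) D) + 16 ≡ X
  column+16≡by-shift i D {X} {t} {k} t+16≡X eq X<n+16 = trans (cong (_+ 16) c≡t) t+16≡X
    where
    t<n : t < n
    t<n = +-cancelʳ-< 16 t n (subst (_< n + 16) (sym t+16≡X) X<n+16)
    c≡t : toℕ (column (offset i) D) ≡ t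
    c≡t = trans (toℕ-column (offset i) D) (y+z≡t+z+k*n⇒y%n≡t 16 k n (trans eq (cong (_+ k * n) (sym t+16≡X))) t<n)

  column-near-seam : ∀ i D → D ≤ 16 →
    (16 ≤ seam i + D × toℕ (column (offset i) D) + 16 ≡ seam i + D) ⊎
    (seam i + D < 16 × toℕ (column (offset i) D) + 16 ≡ seam i + D + n)
  column-near-seam i D D≤16 with 16 ≤? seam i + D
  ... | yes 16≤s+D = inj₁ (16≤s+D , column+16≡by-shift i D {k = (toℕ i + 8) / n + 8}
                                      (m∸n+n≡m 16≤s+D) (offset-seam i D) (+-mono-<-≤ (m%n<n (toℕ i + 8) n) D≤16))
  ... | no  s+D≱16 = inj₂ (≰⇒> s+D≱16 , column+16≡by-shift i D {k = (toℕ i + 8) / n + 7} (m∸n+n≡m 16≤s+D+n)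
                                         (trans (offset-seam i D) (lemma (seam i + D) ((toℕ i + 8) / n) n))
                                         (subst (seam i + D + n <_) (+-comm 16 n) (+-monoˡ-< n (≰⇒> s+D≱16))))
    where
    16≤s+D+n : 16 ≤ seam i + D + n
    16≤s+D+n = ≤-trans (≤-trans (m≤m+n 16 6) 22≤n) (m≤n+m n (seam i + D))
    lemma : ∀ x q n → x + (q + 8) * n ≡ x + n + (q + 7) * n
    lemma = solve-∀

  +n-mod-4 : ∀ x → (x + n) % 4 ≡ (x + 2) % 4
  +n-mod-4 x = trans (%-distribˡ-+ x n 4) (trans (cong (λ y → (x % 4 + y) % 4) n%4≡2) (sym (%-distribˡ-+ x 2 4)))

  periodic-column : ∀ {c X} l → c + 16 ≡ X → 22 ≤ X → toℕ (oddColour l c) ≡ toℕ (periodic l (X % 4))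
  periodic-column {c} {X} l c+16≡X 22≤X = trans (oddColour-periodic l c 6≤c)
    (cong (λ x → toℕ (periodic l x)) (trans (sym ([m+kn]%n≡m%n c 4 4)) (cong (_% 4) c+16≡X)))
    where
    6≤c : 6 ≤ c
    6≤c = +-cancelʳ-≤ 16 6 c (subst (22 ≤_) (sym c+16≡X) 22≤X)

  seam-agrees : ∀ i l D → D ≤ 16 → seamLadder (seam i) (l , D) ≡ suc (toℕ (oddColouring (project (offset i) (l , D))))
  seam-agrees i l D D≤16 with column-near-seam i D D≤16
  ... | inj₁ (16≤s+D , c+16≡s+D) = begin
    seamLadder (seam i) (l , D)                ≡⟨ seamLadder-right (seam i) l D 16≤s+D ⟩
    suc (toℕ (oddColour l (seam i + D ∸ 16)))  ≡⟨ cong (λ c → suc (toℕ (oddColour l c))) s+D∸16≡c ⟩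
    suc (toℕ (oddColour l c))                   ∎
    where
    open ≡-Reasoning
    c = toℕ (column (offset i) D)
    s+D∸16≡c : seam i + D ∸ 16 ≡ c
    s+D∸16≡c = trans (cong (_∸ 16) (sym c+16≡s+D)) (m+n∸n≡m c 16)
  ... | inj₂ (s+D<16 , c+16≡s+D+n) = begin
    seamLadder (seam i) (l , D)                    ≡⟨ seamLadder-left (seam i) l D s+D<16 ⟩
    suc (toℕ (periodic l ((seam i + D + 2) % 4)))       ≡⟨ cong (suc ∘ toℕ ∘ periodic l) (+n-mod-4 (seam i + D)) ⟨
    suc (toℕ (periodic l ((seam i + D + n) % 4)))       ≡⟨ cong suc (periodic-column l c+16≡s+D+n 22≤s+D+n) ⟨
    suc (toℕ (oddColour l (toℕ (column (offset i) D))))  ∎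
    where
    open ≡-Reasoning
    22≤s+D+n : 22 ≤ seam i + D + n
    22≤s+D+n = ≤-trans 22≤n (m≤n+m n _)

  periodic-agrees : ∀ i l D → D ≤ 16 → ¬ seam i < 22 →
                    periodicLadder (seam i % 4) (l , D) ≡ suc (toℕ (oddColouring (project (offset i) (l , D))))
  periodic-agrees i l D D≤16 s≮22 with column-near-seam i D D≤16
  ... | inj₁ (_ , c+16≡s+D) = begin
    suc (toℕ (periodic l ((seam i % 4 + D) % 4)))        ≡⟨ cong (suc ∘ toℕ ∘ periodic l) ([m%d+n]%d≡[m+n]%d (seam i) D 4) ⟩
    suc (toℕ (periodic l ((seam i + D) % 4)))            ≡⟨ cong suc (periodic-column l c+16≡s+D 22≤s+D) ⟨
    suc (toℕ (oddColour l (toℕ (column (offset i) D))))  ∎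
    where
    open ≡-Reasoning
    22≤s+D : 22 ≤ seam i + D
    22≤s+D = ≤-trans (≮⇒≥ s≮22) (m≤m+n _ D)
  ... | inj₂ (s+D<16 , _) =
    contradiction s+D<16 (≤⇒≯ (≤-trans (≤-trans (m≤m+n 16 6) (≮⇒≥ s≮22)) (m≤m+n _ D)))

  certificate : ∀ i l → Certificate oddColouring i l
  certificate i l with seam i <? 22
  ... | yes s<22 = record
    { colour            = seamLadder (seam i)
    ; over-centre       = isCentre (l , 8)
    ; packed            = subst (λ b → T (packedAround (seamLadder (seam i)) b (l , 8) (isCentre (l , 8))))
                                (seam-parity i) (seamLadder-packed (seam i) s<22 l)
    ; colour-agrees     = λ l′ D D≤16 → seam-agrees i l′ D D≤16
    ; over-centre-sound = isCentre-sound i l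
    }
  ... | no s≮22 = record
    { colour            = periodicLadder (seam i % 4)
    ; over-centre       = isCentre (l , 8)
    ; packed            = subst (λ b → T (packedAround (periodicLadder (seam i % 4)) b (l , 8) (isCentre (l , 8))))
                                (trans (m∣n⇒o%n%m≡o%m 2 4 (seam i) (divides 2 refl)) (seam-parity i))
                                (periodicLadder-packed (seam i % 4) (m%n<n (seam i) 4) l)
    ; colour-agrees     = λ l′ D D≤16 → periodic-agrees i l′ D D≤16 s≮22
    ; over-centre-sound = isCentre-sound i l
    }

  oddColouring-packing : IsPackingColouring (H r) 7 oddColouring
  oddColouring-packing = packing-from-certificates oddColouring (+-monoʳ-≤ 7 (z≤n {1})) certificate

computed-odd-packing : ∀ r′ → T (Covering.Computed.allLocalChecks r′ oddColouring) →
                       IsPackingColouring (H (suc r′)) 7 oddColouring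
computed-odd-packing r′ ok = packing-from-certificates oddColouring (+-monoʳ-≤ 7 (z≤n {1})) (computed-certificate ok)
  where open Covering r′
        open Computed oddColouring

-- Lower bounds

rungHas4 : (LadderVertex → ℕ) → ℕ → Bool
rungHas4 g D = isYes (g (1F , D) ≟ 4) ∨ isYes (g (1F , suc D) ≟ 4)

rungHas4-cong : ∀ g g′ D D′ → g (1F , D) ≡ g′ (1F , D′) → g (1F , suc D) ≡ g′ (1F , suc D′) →
                rungHas4 g D ≡ rungHas4 g′ D′
rungHas4-cong _ _ _ _ eq eq′ = cong₂ (λ x y → isYes (x ≟ 4) ∨ isYes (y ≟ 4)) eq eq′

module FourColours = PackingSearch _≟ᴸ_ (near 0) 4 (λ _ → false)
module FiveColours = PackingSearch _≟ᴸ_ (near 0) 5 (λ g → rungHas4 g 8 xor rungHas4 g 10)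

four-colours-fail : T (FourColours.search (window 8 4) [])
four-colours-fail = _

four-colour-distances : T (distancesCertified 0 4 (window 8 4))
four-colour-distances = _

five-colours-alternate : T (FiveColours.search (window 7 6) [])
five-colours-alternate = _

five-colour-distances : T (distancesCertified 0 5 (window 7 6))
five-colour-distances = _

module LowerBounds (r′ : ℕ) where
  open Covering r′

  lifted-packed : ∀ {K} (π : Vertex (H r) → Fin K) → IsPackingColouring (H r) K π → ∀ a lo w → a % 2 ≡ 0 →
                  w ≤ n → T (distancesCertified 0 K (window lo w)) →
                  ∀ {x y} → x ∈ window lo w → y ∈ window lo w → x ≢ y → π (project a x) ≡ π (project a y) →
                  ¬ T (near 0 x y (suc (toℕ (π (project a x)))))
  lifted-packed π packing a lo w a-even w≤n certified {x} {y} x∈ y∈ x≢y same-colour close =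
    packing (project a x) (project a y) (x≢y ∘ project-injective-window a lo w w≤n x∈ y∈) same-colour
      (project-DistLe a (subst (λ b → DistLe (Ladder b) x y (suc (toℕ (π (project a x))))) (sym a-even)
        (near-sound certified x∈ y∈ (toℕ<n (π (project a x))) close)))

  no-packing-4 : 4 ≤ n → ¬ HasPackingColouring (H r) 4
  no-packing-4 4≤n (π , packing) =
    proj₁ (proj₂ (FourColours.search-sound (window 8 4) (π ∘ project 0)
                   (lifted-packed π packing 0 8 4 refl 4≤n four-colour-distances) four-colours-fail))

  module Alternation (π : Vertex (H r) → Fin 5) (packing : IsPackingColouring (H r) 5 π) (6≤n : 6 ≤ n) where

    liftedAt : ℕ → LadderVertex → ℕ
    liftedAt t z = suc (toℕ (π (project (2 * t) z)))

    has4 : ℕ → Bool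
    has4 t = rungHas4 (liftedAt t) 8

    liftedAt-shift : ∀ t D → liftedAt t (1F , 2 + D) ≡ liftedAt (suc t) (1F , D)
    liftedAt-shift t D = cong (suc ∘ toℕ ∘ π ∘ (1F ,_))
      (column-≡ (2 * t) (2 + D) (trans (cong (_% n) (lemma t D)) (sym (toℕ-column (2 * suc t) D))))
      where
      lemma : ∀ t D → 2 * t + (2 + D) ≡ 2 * suc t + D
      lemma = solve-∀

    liftedAt-period : ∀ D → liftedAt r (1F , D) ≡ liftedAt 0 (1F , D)
    liftedAt-period D = cong (suc ∘ toℕ ∘ π ∘ (1F ,_)) (column-≡ n D (begin
      (n + D) % n            ≡⟨ cong (_% n) (+-comm n D) ⟩
      (D + n) % n            ≡⟨ [m+n]%n≡m%n D n ⟩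
      D % n                  ≡⟨ toℕ-column 0 D ⟨
      toℕ (column 0 D)       ∎))
      where open ≡-Reasoning

    has4-alternates : ∀ t → has4 (suc t) ≡ not (has4 t)
    has4-alternates t =
      let g , exactly-one , g≗lifted = FiveColours.search-sound (window 7 6) (π ∘ project (2 * t))
                                         (lifted-packed π packing (2 * t) 7 6 (2*m%2≡0 t) 6≤n five-colour-distances)
                                         five-colours-alternate
          agrees : ∀ D {7≤D : True (7 ≤? D)} {D<13 : True (D <? 13)} → g (1F , D) ≡ liftedAt t (1F , D)
          agrees D {7≤D} {D<13} = g≗lifted (∈-window 7 6 (toWitness 7≤D) (toWitness D<13))
      in begin
      has4 (suc t)              ≡⟨ rungHas4-cong (liftedAt t) (liftedAt (suc t)) 10 8
                                                 (liftedAt-shift t 8) (liftedAt-shift t 9) ⟨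
      rungHas4 (liftedAt t) 10  ≡⟨ rungHas4-cong g (liftedAt t) 10 10 (agrees 10) (agrees 11) ⟨
      rungHas4 g 10             ≡⟨ xor-not exactly-one ⟩
      not (rungHas4 g 8)        ≡⟨ cong not (rungHas4-cong g (liftedAt t) 8 8 (agrees 8) (agrees 9)) ⟩
      not (has4 t)              ∎
      where open ≡-Reasoning

  no-packing-5 : 6 ≤ n → ¬ 2 ∣ r → ¬ HasPackingColouring (H r) 5
  no-packing-5 6≤n 2∤r (π , packing) with odd⇒suc-double 2∤r
  ... | s , r≡1+2s = not-¬ has4-period (trans (cong has4 r≡1+2s) (alternating-odd has4 has4-alternates s))
    where
    open Alternation π packing 6≤n
    has4-period : has4 r ≡ has4 0
    has4-period = rungHas4-cong (liftedAt r) (liftedAt 0) 8 8 (liftedAt-period 8) (liftedAt-period 9)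

rung? : ∀ a b → Dec (∃ λ m → a ≡ 2 * m × b ≡ suc (2 * m))
rung? a b with parity a
... | inj₂ odd  = no λ (m , a≡2m , _) → 0≢1+n (trans (sym (2*m%2≡0 m)) (trans (cong (_% 2) (sym a≡2m)) odd))
... | inj₁ even = map′ (λ b≡1+a → a / 2 , even⇒double even , trans b≡1+a (cong suc (even⇒double even)))
                       (λ (m , a≡2m , b≡1+2m) → trans b≡1+2m (cong suc (sym a≡2m)))
                       (b ≟ suc a)

-- The holes stand for the successor modulo 2r hidden inside HAdj and are solved by unification.
H-adj? : ∀ r u v → Dec (HAdj r u v)
H-adj? r (l , i) (l′ , j) =
        (((toℕ l ≟ 0) ⊎-dec (toℕ l ≟ 2)) ×-dec (toℕ l ≟ toℕ l′) ×-dec ((toℕ j ≟ _) ⊎-dec (toℕ i ≟ _)))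
  ⊎-dec ((toℕ i ≟ toℕ j) ×-dec (((toℕ l ≟ 1) ×-dec ((toℕ l′ ≟ 0) ⊎-dec (toℕ l′ ≟ 2)))
                                ⊎-dec ((toℕ l′ ≟ 1) ×-dec ((toℕ l ≟ 0) ⊎-dec (toℕ l ≟ 2)))))
  ⊎-dec ((toℕ l ≟ 1) ×-dec (toℕ l′ ≟ 1) ×-dec (rung? (toℕ i) (toℕ j) ⊎-dec rung? (toℕ j) (toℕ i)))

module H-finite (r : ℕ) = FiniteGraph (H r) *↔× (≡-dec _≟ᶠ_ _≟ᶠ_) (H-adj? r)

odd-packing-7 : ∀ r″ → ¬ 2 ∣ suc (suc r″) → HasPackingColouring (H (suc (suc r″))) 7
odd-packing-7 0 2∤r = contradiction (divides 1 refl) 2∤r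
odd-packing-7 1 _   = _ , computed-odd-packing 2 _
odd-packing-7 2 2∤r = contradiction (divides 2 refl) 2∤r
odd-packing-7 3 _   = _ , computed-odd-packing 4 _
odd-packing-7 4 2∤r = contradiction (divides 3 refl) 2∤r
odd-packing-7 5 _   = _ , computed-odd-packing 6 _
odd-packing-7 6 2∤r = contradiction (divides 4 refl) 2∤r
odd-packing-7 7 _   = _ , computed-odd-packing 8 _
odd-packing-7 8 2∤r = contradiction (divides 5 refl) 2∤r
odd-packing-7 r″@(suc (suc (suc (suc (suc (suc (suc (suc (suc _))))))))) 2∤r with odd⇒suc-double 2∤r
... | s , r≡1+2s = _ , OddColouring.oddColouring-packing (suc r″) 22≤n n%4≡2
  where
  22≤n : 22 ≤ 2 * suc (suc r″)
  22≤n = *-monoʳ-≤ 2 (+-monoʳ-≤ 11 (z≤n {r″ ∸ 9}))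
  n%4≡2 : 2 * suc (suc r″) % 4 ≡ 2
  n%4≡2 = trans (cong (λ x → 2 * x % 4) r≡1+2s) (trans (cong (_% 4) (lemma s)) ([m+kn]%n≡m%n 2 s 4))
    where
    lemma : ∀ s → 2 * suc (2 * s) ≡ 2 + s * 4
    lemma = solve-∀

odd-≥3 : ∀ r″ → ¬ 2 ∣ suc (suc r″) → 3 ≤ suc (suc r″)
odd-≥3 zero    2∤r = contradiction (divides 1 refl) 2∤r
odd-≥3 (suc _) _   = s≤s (s≤s (s≤s z≤n))

theorem10 : (r : ℕ) → 2 ≤ r →
    ((2 ∣ r) → PackingChromaticNumber (H r) 5) ×
    (¬ (2 ∣ r) → Σ ℕ λ k → PackingChromaticNumber (H r) k × 6 ≤ k × k ≤ 7)
theorem10 r 2≤r@(s≤s (s≤s {n = r″} z≤n)) = even-case , odd-case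
  where
  open LowerBounds (suc r″)

  even-case : 2 ∣ r → PackingChromaticNumber (H r) 5
  even-case 2∣r = packingChromaticNumber-suc (_ , EvenColouring.evenColouring-packing (suc r″) (*-monoʳ-∣ 2 2∣r))
                                             (no-packing-4 (*-monoʳ-≤ 2 2≤r))

  odd-case : ¬ 2 ∣ r → Σ ℕ λ k → PackingChromaticNumber (H r) k × 6 ≤ k × k ≤ 7
  odd-case 2∤r = packingChromaticNumber-between (H-finite.hasPackingColouring? r 6)
                   (no-packing-5 (*-monoʳ-≤ 2 (odd-≥3 r″ 2∤r)) 2∤r) (odd-packing-7 r″ 2∤r)
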